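{- Let $X=x^2$ and let $n$ be a positive integer. The determinant of the $n\times n$ matrix \[ \Bigl(\binom{i-1}{j}X+\binom{i+1}{j+1}\Bigr)_{0\le i,j<n} \] equals \[ \sum_h\binom{n+h}{2h}X^h=\sum_h\binom{2n-h}{h}x^{2n-2h}. \]
   Context: Sums over $h$ run over all integers $h$ with finitely many nonzero terms. Binomial coefficients are $\binom{a}{b}=a(a-1)\cdots(a-b+1)/b!$ for integers $a$ and $b\ge 0$, and $\binom ab=0$ for $b<0$; in particular $\binom{ -1}{j}=(-1)^j$. -}

module Defs where

open import Level using (Level)
open import Algebra.Bundles using (CommutativeRing)
open import Data.Nat.Base as ℕ using (ℕ; zero; suc; _!)
open import Data.Nat.Properties using (_!≢0)
open import Data.Integer.Base as ℤ using (ℤ; +_; -[1+_])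
open import Data.Integer.DivMod using (_/ℕ_)
open import Data.Fin.Base using (Fin; zero; suc; punchIn; toℕ)

falling : ℤ → ℕ → ℤ
falling a zero    = + 1
falling a (suc b) = a ℤ.* falling (a ℤ.- + 1) b

-- Generalised binomial coefficient (a choose b) = a(a-1)...(a-b+1)/b!
-- for a ∈ ℤ and b ∈ ℕ (b ≥ 0); the division is exact.
binom : ℤ → ℕ → ℤ
binom a b = (falling a b) /ℕ (b !)
  where instance _ = b !≢0

module RingDefs {c ℓ : Level} (R : CommutativeRing c ℓ) where
  open CommutativeRing R hiding (zero)

  fromℕ : ℕ → Carrier
  fromℕ zero    = 0#
  fromℕ (suc n) = 1# + fromℕ n

  fromℤ : ℤ → Carrier
  fromℤ (+ n)     = fromℕ n
  fromℤ -[1+ n ]  = - fromℕ (suc n)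

  pow : Carrier → ℕ → Carrier
  pow x zero    = 1#
  pow x (suc n) = x * pow x n

  sumFin : (n : ℕ) → (Fin n → Carrier) → Carrier
  sumFin zero    f = 0#
  sumFin (suc n) f = f zero + sumFin n (λ i → f (suc i))

  sumUpTo : ℕ → (ℕ → Carrier) → Carrier
  sumUpTo zero    f = f zero
  sumUpTo (suc n) f = sumUpTo n f + f (suc n)

  sign : ℕ → Carrier
  sign zero    = 1#
  sign (suc j) = - sign j

  det : (n : ℕ) → (Fin n → Fin n → Carrier) → Carrier
  det zero    M = 1#
  det (suc n) M =
    sumFin (suc n) (λ j → sign (toℕ j) * (M zero j
                          * det n (λ i k → M (suc i) (punchIn j k))))

module Submission where

-- Adding every column to the next one and then
-- subtracting every row from the next one produces the first row (X+1, 1, 0, …)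
-- above a Pascal family of rows (each row is the previous one plus its shift)
-- starting from (1, X+2, 1, 0, …).  Repeated row differences reduce such a family
-- to successive shifts of its first row, i.e. to the tridiagonal matrix with
-- diagonal (X+1, X+2, X+2, …) and ones beside the diagonal.  Its determinants obey
-- the continuant recurrence, which b n and its companion B n = Σ_h C(n+h+1,2h+1) X^h
-- satisfy by Pascal's rule.

open import Defs
open import Data.Nat.Base as ℕ using (ℕ; zero; suc; _!; _∸_; NonZero)
open import Data.Nat.Properties using (_!≢0)
import Data.Nat.Properties as ℕP
open import Data.Nat.DivMod using (m*n/n≡m; n/n≡1; n%n≡0)
open import Data.Nat.Combinatorics using (_C_; nCk+nC[k+1]≡[n+1]C[k+1]; k>n⇒nCk≡0; nCk≡nC[n∸k])
open import Data.Nat.Tactic.RingSolver using (solve-∀)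
open import Data.Integer.Base as ℤ using (ℤ; +_; -[1+_])
import Data.Integer.Properties as ℤP
import Data.Integer.Tactic.RingSolver as ℤSolver
open import Data.Integer.DivMod using (_/ℕ_)
open import Data.Sum using (_⊎_; inj₁; inj₂)
open import Data.Product using (Σ; _×_; _,_; proj₁; proj₂)
open import Relation.Binary.Definitions using (tri<; tri≈; tri>)
open import Data.Sign.Base as Sign using (Sign)
open import Data.Maybe.Base using (Maybe; just; nothing)
open import Relation.Nullary using (yes; no)
open import Relation.Binary.PropositionalEquality as ≡ using (_≡_; _≢_)
open import Data.Empty using (⊥-elim)
open import Function.Base using (_∘_)
open import Algebra.Bundles using (CommutativeRing)
open import Data.Fin.Base as Fin using (Fin; toℕ; punchIn)
open import Algebra.Solver.Ring.AlmostCommutativeRing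
  using (fromCommutativeRing; _-Raw-AlmostCommutative⟶_)
import Algebra.Solver.Ring as RingSolver

-- The generalised binomial coefficients of Defs at the two kinds of top entry
-- occurring in the matrix: (n choose k) = n C k for n ≥ 0, and (-1 choose j) = (-1)^j.
module Binomial where
  open ≡ using (refl; sym; trans; cong; cong₂)
  open ≡.≡-Reasoning

  fallingℕ : ℕ → ℕ → ℕ
  fallingℕ n zero    = 1
  fallingℕ n (suc k) = n ℕ.* fallingℕ (ℕ.pred n) k

  falling-ℕ : ∀ n k → falling (+ n) k ≡ + fallingℕ n k
  falling-ℕ n       zero    = refl
  falling-ℕ zero    (suc k) = refl
  falling-ℕ (suc n) (suc k) = begin
    + suc n ℤ.* falling (+ n) k    ≡⟨ cong (+ suc n ℤ.*_) (falling-ℕ n k) ⟩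
    + suc n ℤ.* + fallingℕ n k     ≡⟨ ℤP.pos-* (suc n) (fallingℕ n k) ⟨
    + fallingℕ (suc n) (suc k)     ∎

  -- Pascal's rule for falling factorials:
  -- n^(k+1) + (k+1) n^k = (n+1) n^k, proved without truncated subtraction.
  fallingℕ-pascal : ∀ n k → fallingℕ n (suc k) ℕ.+ suc k ℕ.* fallingℕ n k ≡ suc n ℕ.* fallingℕ n k
  fallingℕ-pascal zero    zero    = refl
  fallingℕ-pascal zero    (suc k) = ℕP.*-zeroʳ (suc (suc k))
  fallingℕ-pascal (suc n) zero    = oneStep (suc n)
    where
    oneStep : ∀ m → m ℕ.* 1 ℕ.+ 1 ℕ.* 1 ≡ suc m ℕ.* 1
    oneStep = solve-∀
  fallingℕ-pascal (suc n) (suc k) = begin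
    suc n ℕ.* A ℕ.+ suc (suc k) ℕ.* (suc n ℕ.* F)  ≡⟨ regroup (suc n) A (suc k) F ⟩
    suc n ℕ.* (A ℕ.+ suc k ℕ.* F) ℕ.+ suc n ℕ.* F   ≡⟨ cong (λ m → suc n ℕ.* m ℕ.+ suc n ℕ.* F) (fallingℕ-pascal n k) ⟩
    suc n ℕ.* (suc n ℕ.* F) ℕ.+ suc n ℕ.* F         ≡⟨ collect (suc n) F ⟩
    suc (suc n) ℕ.* (suc n ℕ.* F)                  ∎
    where
    A = fallingℕ n (suc k)
    F = fallingℕ n k
    regroup : ∀ m a l f → m ℕ.* a ℕ.+ suc l ℕ.* (m ℕ.* f) ≡ m ℕ.* (a ℕ.+ l ℕ.* f) ℕ.+ m ℕ.* f
    regroup = solve-∀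
    collect : ∀ m f → m ℕ.* (m ℕ.* f) ℕ.+ m ℕ.* f ≡ suc m ℕ.* (m ℕ.* f)
    collect = solve-∀

  fallingℕ≡C*! : ∀ n k → fallingℕ n k ≡ (n C k) ℕ.* k !
  fallingℕ≡C*! n       zero    = refl
  fallingℕ≡C*! zero    (suc k) = refl
  fallingℕ≡C*! (suc n) (suc k) = begin
    suc n ℕ.* fallingℕ n k                                  ≡⟨ fallingℕ-pascal n k ⟨
    fallingℕ n (suc k) ℕ.+ suc k ℕ.* fallingℕ n k
      ≡⟨ cong₂ (λ a b → a ℕ.+ suc k ℕ.* b) (fallingℕ≡C*! n (suc k)) (fallingℕ≡C*! n k) ⟩
    (n C suc k) ℕ.* suc k ! ℕ.+ suc k ℕ.* ((n C k) ℕ.* k !) ≡⟨ factor (n C suc k) (n C k) k (k !) ⟩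
    ((n C k) ℕ.+ (n C suc k)) ℕ.* suc k !                   ≡⟨ cong (ℕ._* suc k !) (nCk+nC[k+1]≡[n+1]C[k+1] n k) ⟩
    (suc n C suc k) ℕ.* suc k !                             ∎
    where
    factor : ∀ b a k f → b ℕ.* (suc k ℕ.* f) ℕ.+ suc k ℕ.* (a ℕ.* f) ≡ (a ℕ.+ b) ℕ.* (suc k ℕ.* f)
    factor = solve-∀

  binom-ℕ : ∀ n k → binom (+ n) k ≡ + (n C k)
  binom-ℕ n k = begin
    (falling (+ n) k /ℕ k !)           ≡⟨ cong (λ z → (z /ℕ k !) {{k !≢0}}) (falling-ℕ n k) ⟩
    + (fallingℕ n k ℕ./ k !)           ≡⟨ cong (λ z → + (z ℕ./ k !) {{k !≢0}}) (fallingℕ≡C*! n k) ⟩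
    + ((n C k) ℕ.* k ! ℕ./ k !)        ≡⟨ cong +_ (m*n/n≡m (n C k) (k !)) ⟩
    + (n C k)                          ∎
    where instance _ = k !≢0

  signℤ : ℕ → ℤ
  signℤ zero    = + 1
  signℤ (suc k) = ℤ.- signℤ k

  risingℕ : ℕ → ℕ → ℕ
  risingℕ m zero    = 1
  risingℕ m (suc k) = m ℕ.* risingℕ (suc m) k

  falling-negative : ∀ m k → falling -[1+ m ] k ≡ signℤ k ℤ.* + risingℕ (suc m) k
  falling-negative m zero    = refl
  falling-negative m (suc k) = begin
    -[1+ m ] ℤ.* falling (-[1+ m ] ℤ.- + 1) k           ≡⟨ cong (λ a → -[1+ m ] ℤ.* falling -[1+ suc a ] k) (ℕP.+-identityʳ m) ⟩
    -[1+ m ] ℤ.* falling -[1+ suc m ] k                ≡⟨ cong (-[1+ m ] ℤ.*_) (falling-negative (suc m) k) ⟩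
    -[1+ m ] ℤ.* (signℤ k ℤ.* + risingℕ (suc (suc m)) k) ≡⟨ swapSign (signℤ k) (+ suc m) _ ⟩
    ℤ.- signℤ k ℤ.* (+ suc m ℤ.* + risingℕ (suc (suc m)) k) ≡⟨ cong (ℤ.- signℤ k ℤ.*_) (ℤP.pos-* (suc m) _) ⟨
    ℤ.- signℤ k ℤ.* + risingℕ (suc m) (suc k)            ∎
    where
    swapSign : ∀ s a r → (ℤ.- a) ℤ.* (s ℤ.* r) ≡ ℤ.- s ℤ.* (a ℤ.* r)
    swapSign = ℤSolver.solve-∀

  risingℕ-! : ∀ m k → risingℕ (suc m) k ℕ.* m ! ≡ (m ℕ.+ k) !
  risingℕ-! m zero    = trans (ℕP.+-identityʳ (m !)) (cong _! (sym (ℕP.+-identityʳ m)))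
  risingℕ-! m (suc k) = begin
    suc m ℕ.* risingℕ (suc (suc m)) k ℕ.* m !   ≡⟨ shuffle (suc m) (risingℕ (suc (suc m)) k) (m !) ⟩
    risingℕ (suc (suc m)) k ℕ.* (suc m) !       ≡⟨ risingℕ-! (suc m) k ⟩
    (suc m ℕ.+ k) !                             ≡⟨ cong _! (ℕP.+-suc m k) ⟨
    (m ℕ.+ suc k) !                             ∎
    where
    shuffle : ∀ a r f → a ℕ.* r ℕ.* f ≡ r ℕ.* (a ℕ.* f)
    shuffle = solve-∀

  risingℕ-one : ∀ k → risingℕ 1 k ≡ k !
  risingℕ-one k = trans (sym (ℕP.*-identityʳ _)) (risingℕ-! 0 k)

  signℤ-unit : ∀ k → signℤ k ≡ + 1 ⊎ signℤ k ≡ -[1+ 0 ]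
  signℤ-unit zero = inj₁ refl
  signℤ-unit (suc k) with signℤ-unit k
  ... | inj₁ e = inj₂ (cong ℤ.-_ e)
  ... | inj₂ e = inj₁ (cong ℤ.-_ e)

  unit*d/d : ∀ s d .{{_ : ℕ.NonZero d}} → s ≡ + 1 ⊎ s ≡ -[1+ 0 ] → (s ℤ.* + d) /ℕ d ≡ s
  unit*d/d _ (suc p) (inj₁ refl) =
    trans (cong (_/ℕ suc p) (ℤP.*-identityˡ (+ suc p))) (cong +_ (n/n≡1 (suc p)))
  unit*d/d _ (suc p) (inj₂ refl) = trans (cong (_/ℕ suc p) (ℤP.-1*i≡-i (+ suc p))) minusOne
    where
    -- (p+1) % (p+1) = 0, so the division of -(p+1) takes its exact branch
    minusOne : -[1+ p ] /ℕ suc p ≡ -[1+ 0 ]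
    minusOne with suc p ℕ.% suc p | n%n≡0 (suc p)
    ... | .zero | refl = cong (λ z → ℤ.- (+ z)) (n/n≡1 (suc p))

  binom-minusOne : ∀ j → binom -[1+ 0 ] j ≡ signℤ j
  binom-minusOne j = begin
    falling -[1+ 0 ] j /ℕ j !            ≡⟨ cong (λ z → (z /ℕ j !) {{j !≢0}}) (falling-negative 0 j) ⟩
    signℤ j ℤ.* + risingℕ 1 j /ℕ j !     ≡⟨ cong (λ z → (signℤ j ℤ.* + z /ℕ j !) {{j !≢0}}) (risingℕ-one j) ⟩
    signℤ j ℤ.* + (j !) /ℕ j !           ≡⟨ unit*d/d (signℤ j) (j !) (signℤ-unit j) ⟩
    signℤ j                              ∎
    where instance _ = j !≢0


-- The canonical map ℤ → R is a ring homomorphism; this lets the ring solver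
-- use integer coefficients, so that identities with cancellation hold by
-- normalisation.
module IntegerCoefficients {c ℓ} (R : CommutativeRing c ℓ) where
  open CommutativeRing R hiding (zero)
  open RingDefs R
  open import Algebra.Properties.Ring ring using (-0#≈0#; -‿involutive; -‿+-comm; -1*x≈-x)
  open import Algebra.Properties.CommutativeSemigroup +-commutativeSemigroup
    using (x∙yz≈y∙xz) renaming (interchange to +-interchange)
  open import Algebra.Properties.CommutativeSemigroup *-commutativeSemigroup
    using () renaming (interchange to *-interchange)
  open import Algebra.Properties.Semiring.Mult semiring using (×-homo-+; ×1-homo-*)
    renaming (_×_ to _×ᴿ_)
  open import Relation.Binary.Reasoning.Setoid setoid

  -- fromℕ n is the n-fold sum of 1#, for which the library has the homomorphism laws.
  fromℕ≈× : ∀ n → fromℕ n ≈ n ×ᴿ 1#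
  fromℕ≈× zero    = refl
  fromℕ≈× (suc n) = +-congˡ (fromℕ≈× n)

  fromℕ-+ : ∀ m n → fromℕ (m ℕ.+ n) ≈ fromℕ m + fromℕ n
  fromℕ-+ m n = begin
    fromℕ (m ℕ.+ n)      ≈⟨ fromℕ≈× (m ℕ.+ n) ⟩
    (m ℕ.+ n) ×ᴿ 1#       ≈⟨ ×-homo-+ 1# m n ⟩
    m ×ᴿ 1# + n ×ᴿ 1#      ≈⟨ +-cong (fromℕ≈× m) (fromℕ≈× n) ⟨
    fromℕ m + fromℕ n    ∎

  fromℕ-* : ∀ m n → fromℕ (m ℕ.* n) ≈ fromℕ m * fromℕ n
  fromℕ-* m n = begin
    fromℕ (m ℕ.* n)      ≈⟨ fromℕ≈× (m ℕ.* n) ⟩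
    (m ℕ.* n) ×ᴿ 1#       ≈⟨ ×1-homo-* m n ⟩
    m ×ᴿ 1# * n ×ᴿ 1#      ≈⟨ *-cong (fromℕ≈× m) (fromℕ≈× n) ⟨
    fromℕ m * fromℕ n    ∎

  fromℤ-⊖ : ∀ m n → fromℤ (m ℤ.⊖ n) ≈ fromℕ m - fromℕ n
  fromℤ-⊖ m       zero    = sym (trans (+-congˡ -0#≈0#) (+-identityʳ _))
  fromℤ-⊖ zero    (suc n) = sym (+-identityˡ _)
  fromℤ-⊖ (suc m) (suc n) = begin
    fromℤ (suc m ℤ.⊖ suc n)                   ≡⟨ ≡.cong fromℤ (ℤP.[1+m]⊖[1+n]≡m⊖n m n) ⟩
    fromℤ (m ℤ.⊖ n)                           ≈⟨ fromℤ-⊖ m n ⟩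
    fromℕ m - fromℕ n                         ≈⟨ +-identityˡ _ ⟨
    0# + (fromℕ m - fromℕ n)                  ≈⟨ +-congʳ (-‿inverseʳ 1#) ⟨
    (1# - 1#) + (fromℕ m - fromℕ n)           ≈⟨ +-interchange 1# (- 1#) (fromℕ m) (- fromℕ n) ⟩
    (1# + fromℕ m) + (- 1# - fromℕ n)         ≈⟨ +-congˡ (-‿+-comm 1# (fromℕ n)) ⟩
    (1# + fromℕ m) - (1# + fromℕ n)           ∎

  fromℤ-+ : ∀ a b → fromℤ (a ℤ.+ b) ≈ fromℤ a + fromℤ b
  fromℤ-+ (+ m)    (+ n)    = fromℕ-+ m n
  fromℤ-+ (+ m)    -[1+ n ] = fromℤ-⊖ m (suc n)
  fromℤ-+ -[1+ m ] (+ n)    = trans (fromℤ-⊖ n (suc m)) (+-comm _ _)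
  fromℤ-+ -[1+ m ] -[1+ n ] = begin
    - (1# + fromℕ (suc m ℕ.+ n))          ≈⟨ -‿cong (+-congˡ (fromℕ-+ (suc m) n)) ⟩
    - (1# + (fromℕ (suc m) + fromℕ n))     ≈⟨ -‿cong (x∙yz≈y∙xz 1# _ _) ⟩
    - (fromℕ (suc m) + fromℕ (suc n))      ≈⟨ -‿+-comm _ _ ⟨
    - fromℕ (suc m) - fromℕ (suc n)        ∎

  fromℤ-neg : ∀ a → fromℤ (ℤ.- a) ≈ - fromℤ a
  fromℤ-neg (+ zero)  = sym -0#≈0#
  fromℤ-neg (+ suc n) = refl
  fromℤ-neg -[1+ n ]  = sym (-‿involutive _)

  -- Multiplication is handled through the sign/magnitude decomposition of ℤ.
  signᴿ : Sign → Carrier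
  signᴿ Sign.+ = 1#
  signᴿ Sign.- = - 1#

  signᴿ-* : ∀ s t → signᴿ (s Sign.* t) ≈ signᴿ s * signᴿ t
  signᴿ-* Sign.+ t      = sym (*-identityˡ _)
  signᴿ-* Sign.- Sign.+ = sym (*-identityʳ _)
  signᴿ-* Sign.- Sign.- = sym (trans (-1*x≈-x _) (-‿involutive _))

  fromℤ-◃ : ∀ s n → fromℤ (s ℤ.◃ n) ≈ signᴿ s * fromℕ n
  fromℤ-◃ s      zero    = sym (zeroʳ _)
  fromℤ-◃ Sign.+ (suc n) = sym (*-identityˡ _)
  fromℤ-◃ Sign.- (suc n) = sym (-1*x≈-x _)

  fromℤ-signAbs : ∀ a → fromℤ a ≈ signᴿ (ℤ.sign a) * fromℕ ℤ.∣ a ∣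
  fromℤ-signAbs (+ n)    = sym (*-identityˡ _)
  fromℤ-signAbs -[1+ n ] = sym (-1*x≈-x _)

  fromℤ-* : ∀ a b → fromℤ (a ℤ.* b) ≈ fromℤ a * fromℤ b
  fromℤ-* a b = begin
    fromℤ (a ℤ.* b)                                    ≈⟨ fromℤ-◃ (sa Sign.* sb) (∣a∣ ℕ.* ∣b∣) ⟩
    signᴿ (sa Sign.* sb) * fromℕ (∣a∣ ℕ.* ∣b∣)          ≈⟨ *-cong (signᴿ-* sa sb) (fromℕ-* ∣a∣ ∣b∣) ⟩
    (signᴿ sa * signᴿ sb) * (fromℕ ∣a∣ * fromℕ ∣b∣)     ≈⟨ *-interchange _ _ _ _ ⟩
    (signᴿ sa * fromℕ ∣a∣) * (signᴿ sb * fromℕ ∣b∣)     ≈⟨ *-cong (fromℤ-signAbs a) (fromℤ-signAbs b) ⟨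
    fromℤ a * fromℤ b                                  ∎
    where
    sa = ℤ.sign a
    sb = ℤ.sign b
    ∣a∣ = ℤ.∣ a ∣
    ∣b∣ = ℤ.∣ b ∣

  fromℤ-morphism : CommutativeRing.rawRing ℤP.+-*-commutativeRing
                     -Raw-AlmostCommutative⟶ fromCommutativeRing R
  fromℤ-morphism = record
    { ⟦_⟧ = fromℤ ; +-homo = fromℤ-+ ; *-homo = fromℤ-* ; -‿homo = fromℤ-neg
    ; 0-homo = refl ; 1-homo = +-identityʳ 1# }

  coefficientEquality : ∀ a b → Maybe (fromℤ a ≈ fromℤ b)
  coefficientEquality a b with a ℤP.≟ b
  ... | yes ≡.refl = just refl
  ... | no _     = nothing

  open RingSolver (CommutativeRing.rawRing ℤP.+-*-commutativeRing) (fromCommutativeRing R)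
    fromℤ-morphism coefficientEquality public
    using (solve; _:=_; _:+_; _:*_; _:-_; :-_; con)

-- Indexing by ℕ
-- instead of Fin keeps index arithmetic (shifts, skipped columns) first-order.
module Determinant {c ℓ} (R : CommutativeRing c ℓ) where
  open CommutativeRing R hiding (zero)
  open RingDefs R
  open IntegerCoefficients R

  Row : Set c
  Row = ℕ → Carrier

  Matrix : Set c
  Matrix = ℕ → Row

  ∑ : ℕ → Row → Carrier
  ∑ zero    f = 0#
  ∑ (suc n) f = f zero + ∑ n (λ j → f (suc j))

  ∑-cong : ∀ n {f g : Row} → (∀ j → j ℕ.< n → f j ≈ g j) → ∑ n f ≈ ∑ n g
  ∑-cong zero    f≈g = refl
  ∑-cong (suc n) f≈g = +-cong (f≈g 0 (ℕ.s≤s ℕ.z≤n)) (∑-cong n (λ j j<n → f≈g (suc j) (ℕ.s≤s j<n)))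

  ∑-+ : ∀ n (f g : Row) → ∑ n (λ j → f j + g j) ≈ ∑ n f + ∑ n g
  ∑-+ zero    f g = sym (+-identityʳ 0#)
  ∑-+ (suc n) f g = trans (+-congˡ (∑-+ n _ _))
    (solve 4 (λ a b c d → (a :+ b) :+ (c :+ d) := (a :+ c) :+ (b :+ d)) refl _ _ _ _)

  ∑-*ˡ : ∀ n a (f : Row) → ∑ n (λ j → a * f j) ≈ a * ∑ n f
  ∑-*ˡ zero    a f = sym (zeroʳ a)
  ∑-*ˡ (suc n) a f = trans (+-congˡ (∑-*ˡ n a _)) (sym (distribˡ _ _ _))

  ∑-zero : ∀ n {f : Row} → (∀ j → j ℕ.< n → f j ≈ 0#) → ∑ n f ≈ 0#
  ∑-zero n f≈0 = trans (∑-cong n f≈0) (zero-sum n)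
    where
    zero-sum : ∀ n → ∑ n (λ _ → 0#) ≈ 0#
    zero-sum zero    = refl
    zero-sum (suc n) = trans (+-identityˡ _) (zero-sum n)

  -- skip j k: the k-th index different from j (ℕ analogue of Fin.punchIn).
  skip : ℕ → ℕ → ℕ
  skip zero    k       = suc k
  skip (suc j) zero    = zero
  skip (suc j) (suc k) = suc (skip j k)

  skip-< : ∀ {n} j k → j ℕ.< suc n → k ℕ.< n → skip j k ℕ.< suc n
  skip-< zero    k       _           k<n         = ℕ.s≤s k<n
  skip-< (suc j) zero    _           _           = ℕ.s≤s ℕ.z≤n
  skip-< (suc j) (suc k) (ℕ.s≤s j<n) (ℕ.s≤s k<n) = ℕ.s≤s (skip-< j k j<n k<n)

  minor : Matrix → ℕ → Matrix
  minor N j r k = N (suc r) (skip j k)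

  cofactorTerm : ℕ → Matrix → ℕ → Carrier
  Det : ℕ → Matrix → Carrier

  cofactorTerm n N j = sign j * (N 0 j * Det n (minor N j))

  Det zero    N = 1#
  Det (suc n) N = ∑ (suc n) (cofactorTerm n N)

  Det-cong : ∀ n {A B : Matrix} → (∀ i j → i ℕ.< n → j ℕ.< n → A i j ≈ B i j) → Det n A ≈ Det n B
  Det-cong zero    A≈B = refl
  Det-cong (suc n) A≈B = ∑-cong (suc n) λ j j<n →
    *-congˡ {sign j} (*-cong (A≈B 0 j (ℕ.s≤s ℕ.z≤n) j<n)
      (Det-cong n (λ r k r<n k<n → A≈B (suc r) (skip j k) (ℕ.s≤s r<n) (skip-< j k j<n k<n))))

  Det-one : ∀ N → Det 1 N ≈ N 0 0
  Det-one N = trans (+-identityʳ _) (trans (*-identityˡ _) (*-identityʳ _))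

  cofactorTerm-zero : ∀ n N j → Det n (minor N j) ≈ 0# → cofactorTerm n N j ≈ 0#
  cofactorTerm-zero n N j minor≈0 =
    trans (*-congˡ (trans (*-congˡ minor≈0) (zeroʳ _))) (zeroʳ (sign j))

  cofactorTerm-zeroEntry : ∀ n N j → N 0 j ≈ 0# → cofactorTerm n N j ≈ 0#
  cofactorTerm-zeroEntry n N j entry≈0 =
    trans (*-congˡ (trans (*-congʳ entry≈0) (zeroˡ _))) (zeroʳ (sign j))

  toℕ-punchIn : ∀ {n} (j : Fin (suc n)) (k : Fin n) → toℕ (punchIn j k) ≡ skip (toℕ j) (toℕ k)
  toℕ-punchIn Fin.zero    k           = ≡.refl
  toℕ-punchIn (Fin.suc j) Fin.zero    = ≡.refl
  toℕ-punchIn (Fin.suc j) (Fin.suc k) = ≡.cong suc (toℕ-punchIn j k)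

  sumFin≈∑ : ∀ n (f : Fin n → Carrier) (g : Row) → (∀ j → f j ≈ g (toℕ j)) → sumFin n f ≈ ∑ n g
  sumFin≈∑ zero    f g f≈g = refl
  sumFin≈∑ (suc n) f g f≈g =
    +-cong (f≈g Fin.zero) (sumFin≈∑ n (λ j → f (Fin.suc j)) (λ j → g (suc j)) (λ j → f≈g (Fin.suc j)))

  det≈Det : ∀ n (M : Fin n → Fin n → Carrier) (N : Matrix) →
            (∀ i j → M i j ≈ N (toℕ i) (toℕ j)) → det n M ≈ Det n N
  det≈Det zero    M N M≈N = refl
  det≈Det (suc n) M N M≈N = sumFin≈∑ (suc n) _ (cofactorTerm n N) λ j →
    *-congˡ (*-cong (M≈N Fin.zero j) (det≈Det n _ (minor N (toℕ j)) λ r k →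
      trans (M≈N (Fin.suc r) (punchIn j k)) (reflexive (≡.cong (N (suc (toℕ r))) (toℕ-punchIn j k)))))

module Multilinearity {c ℓ} (R : CommutativeRing c ℓ) where
  open CommutativeRing R hiding (zero)
  open RingDefs R
  open IntegerCoefficients R
  open Determinant R
  open import Algebra.Properties.Ring ring using (-1*x≈-x)
  open import Relation.Binary.Reasoning.Setoid setoid

  -- unskip j b: the position of column b in a minor from which column j was deleted.
  unskip : ℕ → ℕ → ℕ
  unskip zero    zero    = zero
  unskip zero    (suc b) = b
  unskip (suc j) zero    = zero
  unskip (suc j) (suc b) = suc (unskip j b)

  skip-≢ : ∀ j k → skip j k ≢ j
  skip-≢ zero    k       ()
  skip-≢ (suc j) zero    ()
  skip-≢ (suc j) (suc k) e = skip-≢ j k (ℕP.suc-injective e)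

  skip-unskip : ∀ j b → j ≢ b → skip j (unskip j b) ≡ b
  skip-unskip zero    zero    j≢b = ⊥-elim (j≢b ≡.refl)
  skip-unskip zero    (suc b) _   = ≡.refl
  skip-unskip (suc j) zero    _   = ≡.refl
  skip-unskip (suc j) (suc b) j≢b = ≡.cong suc (skip-unskip j b (j≢b ∘ ≡.cong suc))

  unskip-skip : ∀ j k → unskip j (skip j k) ≡ k
  unskip-skip zero    k       = ≡.refl
  unskip-skip (suc j) zero    = ≡.refl
  unskip-skip (suc j) (suc k) = ≡.cong suc (unskip-skip j k)

  unskip-< : ∀ {n} j b → j ℕ.< suc n → b ℕ.< suc n → j ≢ b → unskip j b ℕ.< n
  unskip-< zero    zero    _ _ j≢b = ⊥-elim (j≢b ≡.refl)
  unskip-< zero    (suc b) _ (ℕ.s≤s b<n) _ = b<n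
  unskip-< {suc n} (suc j) zero    _ _ _ = ℕ.s≤s ℕ.z≤n
  unskip-< {suc n} (suc j) (suc b) (ℕ.s≤s j<n) (ℕ.s≤s b<n) j≢b =
    ℕ.s≤s (unskip-< j b j<n b<n (j≢b ∘ ≡.cong suc))
  unskip-< {zero}  (suc j) _ (ℕ.s≤s ()) _ _

  Det-split : ∀ n (N A B : Matrix) x →
              (∀ j → j ℕ.< suc n → cofactorTerm n N j ≈ cofactorTerm n A j + x * cofactorTerm n B j) →
              Det (suc n) N ≈ Det (suc n) A + x * Det (suc n) B
  Det-split n N A B x split = begin
    ∑ (suc n) (cofactorTerm n N)                             ≈⟨ ∑-cong (suc n) split ⟩
    ∑ (suc n) (λ j → cofactorTerm n A j + x * cofactorTerm n B j)
      ≈⟨ ∑-+ (suc n) (cofactorTerm n A) (λ j → x * cofactorTerm n B j) ⟩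
    Det (suc n) A + ∑ (suc n) (λ j → x * cofactorTerm n B j) ≈⟨ +-congˡ (∑-*ˡ (suc n) x (cofactorTerm n B)) ⟩
    Det (suc n) A + x * Det (suc n) B                        ∎

  split-entry : ∀ s a x b d → s * ((a + x * b) * d) ≈ s * (a * d) + x * (s * (b * d))
  split-entry = solve 5 (λ s a x b d → s :* ((a :+ x :* b) :* d) := s :* (a :* d) :+ x :* (s :* (b :* d))) refl

  split-minor : ∀ s a x d e → s * (a * (d + x * e)) ≈ s * (a * d) + x * (s * (a * e))
  split-minor = solve 5 (λ s a x d e → s :* (a :* (d :+ x :* e)) := s :* (a :* d) :+ x :* (s :* (a :* e))) refl

  minor-swap : ∀ n L N j → (∀ r k → L (suc r) (skip j k) ≈ N (suc r) (skip j k)) →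
               sign j * (L 0 j * Det n (minor N j)) ≈ cofactorTerm n L j
  minor-swap n L N j L≈N = *-congˡ (*-congˡ (Det-cong n (λ r k _ _ → sym (L≈N r k))))

  rowLinear : ∀ n b (N A B : Matrix) x → b ℕ.< n →
              (∀ i j → i ≢ b → A i j ≈ N i j) → (∀ i j → i ≢ b → B i j ≈ N i j) →
              (∀ j → N b j ≈ A b j + x * B b j) → Det n N ≈ Det n A + x * Det n B
  rowLinear (suc n) zero N A B x _ A≈N B≈N N₀ = Det-split n N A B x λ j _ → begin
    sign j * (N 0 j * Det n (minor N j))                 ≈⟨ *-congˡ (*-congʳ (N₀ j)) ⟩
    sign j * ((A 0 j + x * B 0 j) * Det n (minor N j))   ≈⟨ split-entry _ _ _ _ _ ⟩
    sign j * (A 0 j * Det n (minor N j)) + x * (sign j * (B 0 j * Det n (minor N j)))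
      ≈⟨ +-cong (minor-swap n A N j (λ r k → A≈N (suc r) (skip j k) λ ()))
                (*-congˡ (minor-swap n B N j (λ r k → B≈N (suc r) (skip j k) λ ()))) ⟩
    cofactorTerm n A j + x * cofactorTerm n B j          ∎
  rowLinear (suc n) (suc b) N A B x (ℕ.s≤s b<n) A≈N B≈N Nb = Det-split n N A B x λ j _ → begin
    sign j * (N 0 j * Det n (minor N j))
      ≈⟨ *-congˡ (*-congˡ (rowLinear n b (minor N j) (minor A j) (minor B j) x b<n
           (λ r k r≢b → A≈N (suc r) (skip j k) (r≢b ∘ ℕP.suc-injective))
           (λ r k r≢b → B≈N (suc r) (skip j k) (r≢b ∘ ℕP.suc-injective))
           (λ k → Nb (skip j k)))) ⟩
    sign j * (N 0 j * (Det n (minor A j) + x * Det n (minor B j)))  ≈⟨ split-minor _ _ _ _ _ ⟩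
    sign j * (N 0 j * Det n (minor A j)) + x * (sign j * (N 0 j * Det n (minor B j)))
      ≈⟨ +-cong (*-congˡ (*-congʳ (sym (A≈N 0 j λ ()))))
                (*-congˡ (*-congˡ (*-congʳ (sym (B≈N 0 j λ ()))))) ⟩
    cofactorTerm n A j + x * cofactorTerm n B j          ∎

  columnLinear : ∀ n b (N A B : Matrix) x → b ℕ.< n →
                 (∀ i j → j ≢ b → A i j ≈ N i j) → (∀ i j → j ≢ b → B i j ≈ N i j) →
                 (∀ i → N i b ≈ A i b + x * B i b) → Det n N ≈ Det n A + x * Det n B
  columnLinear (suc n) b N A B x b<n A≈N B≈N Nb = Det-split n N A B x term
    where
    term : ∀ j → j ℕ.< suc n → cofactorTerm n N j ≈ cofactorTerm n A j + x * cofactorTerm n B j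
    term j j<n with j ℕP.≟ b
    ... | yes ≡.refl = begin
      sign j * (N 0 j * Det n (minor N j))                 ≈⟨ *-congˡ (*-congʳ (Nb 0)) ⟩
      sign j * ((A 0 j + x * B 0 j) * Det n (minor N j))   ≈⟨ split-entry _ _ _ _ _ ⟩
      sign j * (A 0 j * Det n (minor N j)) + x * (sign j * (B 0 j * Det n (minor N j)))
        ≈⟨ +-cong (minor-swap n A N j (λ r k → A≈N (suc r) (skip j k) (skip-≢ j k)))
                  (*-congˡ (minor-swap n B N j (λ r k → B≈N (suc r) (skip j k) (skip-≢ j k)))) ⟩
      cofactorTerm n A j + x * cofactorTerm n B j          ∎
    ... | no j≢b = begin
      sign j * (N 0 j * Det n (minor N j))
        ≈⟨ *-congˡ (*-congˡ (columnLinear n b′ (minor N j) (minor A j) (minor B j) x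
             (unskip-< j b j<n b<n j≢b) (λ r k → A≈N (suc r) (skip j k) ∘ avoids k)
             (λ r k → B≈N (suc r) (skip j k) ∘ avoids k) minor-column)) ⟩
      sign j * (N 0 j * (Det n (minor A j) + x * Det n (minor B j)))  ≈⟨ split-minor _ _ _ _ _ ⟩
      sign j * (N 0 j * Det n (minor A j)) + x * (sign j * (N 0 j * Det n (minor B j)))
        ≈⟨ +-cong (*-congˡ (*-congʳ (sym (A≈N 0 j j≢b))))
                  (*-congˡ (*-congˡ (*-congʳ (sym (B≈N 0 j j≢b))))) ⟩
      cofactorTerm n A j + x * cofactorTerm n B j          ∎
      where
      -- column b of N is column b′ of the minor
      b′ = unskip j b
      avoids : ∀ k → k ≢ b′ → skip j k ≢ b
      avoids k k≢b′ e = k≢b′ (≡.trans (≡.sym (unskip-skip j k)) (≡.cong (unskip j) e))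
      minor-column : ∀ r → minor N j r b′ ≈ minor A j r b′ + x * minor B j r b′
      minor-column r rewrite skip-unskip j b j≢b = Nb (suc r)

  zeroColumn : ∀ n b (N : Matrix) → b ℕ.< n → (∀ i → N i b ≈ 0#) → Det n N ≈ 0#
  zeroColumn n b N b<n Nb≈0 = begin
    Det n N                  ≈⟨ columnLinear n b N N N (- 1#) b<n (λ _ _ _ → refl) (λ _ _ _ → refl) Nb ⟩
    Det n N + - 1# * Det n N ≈⟨ cancel (Det n N) ⟩
    0#                       ∎
    where
    cancel : ∀ d → d + - 1# * d ≈ 0#
    cancel d = trans (+-congˡ (-1*x≈-x d)) (-‿inverseʳ d)
    Nb : ∀ i → N i b ≈ N i b + - 1# * N i b
    Nb i = trans (Nb≈0 i) (sym (cancel (N i b)))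

module Alternating {c ℓ} (R : CommutativeRing c ℓ) where
  open CommutativeRing R hiding (zero)
  open RingDefs R
  open IntegerCoefficients R
  open Determinant R
  open Multilinearity R
  open import Relation.Binary.Reasoning.Setoid setoid

  skip-below : ∀ j k → k ℕ.< j → skip j k ≡ k
  skip-below (suc j) zero    _           = ≡.refl
  skip-below (suc j) (suc k) (ℕ.s≤s k<j) = ≡.cong suc (skip-below j k k<j)

  skip-above : ∀ j k → j ℕ.≤ k → skip j k ≡ suc k
  skip-above zero    k       _           = ≡.refl
  skip-above (suc j) (suc k) (ℕ.s≤s j≤k) = ≡.cong suc (skip-above j k j≤k)

  skip-adjacent : ∀ (f : Row) a k → f a ≈ f (suc a) → f (skip a k) ≈ f (skip (suc a) k)
  skip-adjacent f zero    zero    fa≈fsa = sym fa≈fsa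
  skip-adjacent f zero    (suc k) _      = refl
  skip-adjacent f (suc a) zero    _      = refl
  skip-adjacent f (suc a) (suc k) fa≈fsa = skip-adjacent (f ∘ suc) a k fa≈fsa

  ∑-cancelPair : ∀ m a (f : Row) → suc a ℕ.< m → f a + f (suc a) ≈ 0# →
                 (∀ j → j ℕ.< m → j ≢ a → j ≢ suc a → f j ≈ 0#) → ∑ m f ≈ 0#
  ∑-cancelPair (suc (suc m)) zero f _ pair others = begin
    f 0 + (f 1 + ∑ m (λ j → f (suc (suc j))))  ≈⟨ +-assoc _ _ _ ⟨
    (f 0 + f 1) + ∑ m (λ j → f (suc (suc j)))  ≈⟨ +-cong pair (∑-zero m (λ j j<m →
                                                    others (suc (suc j)) (ℕ.s≤s (ℕ.s≤s j<m)) (λ ()) (λ ()))) ⟩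
    0# + 0#                                    ≈⟨ +-identityʳ 0# ⟩
    0#                                         ∎
  ∑-cancelPair (suc m) (suc a) f (ℕ.s≤s sa<m) pair others = begin
    f 0 + ∑ m (λ j → f (suc j))
      ≈⟨ +-cong (others 0 (ℕ.s≤s ℕ.z≤n) (λ ()) (λ ()))
                (∑-cancelPair m a (f ∘ suc) sa<m pair (λ j j<m j≢a j≢sa →
                   others (suc j) (ℕ.s≤s j<m) (j≢a ∘ ℕP.suc-injective) (j≢sa ∘ ℕP.suc-injective))) ⟩
    0# + 0#                      ≈⟨ +-identityʳ 0# ⟩
    0#                           ∎

  minor-adjacentColumns : ∀ n a j (N : Matrix) → suc a ℕ.< suc n → j ℕ.< suc n → j ≢ a → j ≢ suc a →
                          (∀ i → N i a ≈ N i (suc a)) →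
                          Σ ℕ λ a′ → suc a′ ℕ.< n × (∀ r → minor N j r a′ ≈ minor N j r (suc a′))
  minor-adjacentColumns n a j N sa<n j<n j≢a j≢sa equal with ℕP.<-cmp j a
  ... | tri≈ _ j≡a _ = ⊥-elim (j≢a j≡a)
  ... | tri< j<a _ _ = shiftedLeft a j<a sa<n equal
    where
    shiftedLeft : ∀ a → j ℕ.< a → suc a ℕ.< suc n → (∀ i → N i a ≈ N i (suc a)) →
                  Σ ℕ λ a′ → suc a′ ℕ.< n × (∀ r → minor N j r a′ ≈ minor N j r (suc a′))
    shiftedLeft (suc a′) (ℕ.s≤s j≤a′) (ℕ.s≤s sa<n) equal = a′ , sa<n , λ r →
      ≡.subst₂ (λ u v → N (suc r) u ≈ N (suc r) v)
        (≡.sym (skip-above j a′ j≤a′)) (≡.sym (skip-above j (suc a′) (ℕP.m≤n⇒m≤1+n j≤a′))) (equal (suc r))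
  ... | tri> _ _ a<j = a , ℕP.<-≤-trans sa<j (ℕP.≤-pred j<n) , λ r →
      ≡.subst₂ (λ u v → N (suc r) u ≈ N (suc r) v)
        (≡.sym (skip-below j a a<j)) (≡.sym (skip-below j (suc a) sa<j)) (equal (suc r))
    where
    sa<j : suc a ℕ.< j
    sa<j = ℕP.≤∧≢⇒< a<j (j≢sa ∘ ≡.sym)

  adjacentColumns : ∀ n a (N : Matrix) → suc a ℕ.< n → (∀ i → N i a ≈ N i (suc a)) → Det n N ≈ 0#
  adjacentColumns (suc n) a N sa<n equal = ∑-cancelPair (suc n) a (cofactorTerm n N) sa<n pair others
    where
    -- the two terms have equal entries and minors, and opposite signs
    pair : cofactorTerm n N a + cofactorTerm n N (suc a) ≈ 0#
    pair = begin
      sign a * (N 0 a * Det n (minor N a)) + - sign a * (N 0 (suc a) * Det n (minor N (suc a)))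
        ≈⟨ +-congˡ (*-congˡ (*-cong (sym (equal 0))
             (Det-cong n (λ r k _ _ → sym (skip-adjacent (N (suc r)) a k (equal (suc r))))))) ⟩
      sign a * (N 0 a * Det n (minor N a)) + - sign a * (N 0 a * Det n (minor N a))
        ≈⟨ solve 2 (λ s t → s :* t :+ (:- s) :* t := con (+ 0)) refl _ _ ⟩
      0#  ∎
    others : ∀ j → j ℕ.< suc n → j ≢ a → j ≢ suc a → cofactorTerm n N j ≈ 0#
    others j j<n j≢a j≢sa with minor-adjacentColumns n a j N sa<n j<n j≢a j≢sa equal
    ... | a′ , sa′<n , equal′ = cofactorTerm-zero n N j (adjacentColumns n a′ (minor N j) sa′<n equal′)

  -- In the double expansion along rows 0 and 1, the term using columns a (row 0)
  -- and skip a k (row 1) is paired with the term using these columns the other way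
  -- round; both leave the same minor, and their signs are opposite.
  skip-skip : ∀ a k l → skip (skip a k) (skip (unskip (skip a k) a) l) ≡ skip a (skip k l)
  skip-skip zero    k       l       = ≡.refl
  skip-skip (suc a) zero    l       = ≡.refl
  skip-skip (suc a) (suc k) zero    = ≡.refl
  skip-skip (suc a) (suc k) (suc l) = ≡.cong suc (skip-skip a k l)

  sign-swap : ∀ a k → sign (skip a k) * sign (unskip (skip a k) a) ≈ - (sign a * sign k)
  sign-swap zero    k       = solve 2 (λ s o → (:- s) :* o := :- (o :* s)) refl (sign k) 1#
  sign-swap (suc a) zero    = solve 2 (λ s o → o :* s := :- ((:- s) :* o)) refl (sign a) 1#
  sign-swap (suc a) (suc k) = begin
    - sign (skip a k) * - sign (unskip (skip a k) a) ≈⟨ solve 2 (λ s t → (:- s) :* (:- t) := s :* t) refl _ _ ⟩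
    sign (skip a k) * sign (unskip (skip a k) a)     ≈⟨ sign-swap a k ⟩
    - (sign a * sign k)                              ≈⟨ solve 2 (λ s t → :- (s :* t) := :- ((:- s) :* (:- t))) refl _ _ ⟩
    - (- sign a * - sign k)                          ∎

  ∑∑-antisymmetric : ∀ m (f : ℕ → ℕ → Carrier) →
                     (∀ a k → f (skip a k) (unskip (skip a k) a) ≈ - f a k) →
                     ∑ (suc m) (λ a → ∑ m (f a)) ≈ 0#
  ∑∑-antisymmetric zero    f anti = +-identityʳ 0#
  ∑∑-antisymmetric (suc m) f anti = begin
    ∑ (suc m) (f 0) + ∑ (suc m) (λ a → f (suc a) 0 + ∑ m (g a))
      ≈⟨ +-congˡ (∑-+ (suc m) (λ a → f (suc a) 0) (λ a → ∑ m (g a))) ⟩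
    ∑ (suc m) (f 0) + (∑ (suc m) (λ a → f (suc a) 0) + ∑ (suc m) (λ a → ∑ m (g a)))
      ≈⟨ +-congˡ (+-congˡ (∑∑-antisymmetric m g (λ a k → anti (suc a) (suc k)))) ⟩
    ∑ (suc m) (f 0) + (∑ (suc m) (λ a → f (suc a) 0) + 0#)
      ≈⟨ +-congˡ (+-identityʳ _) ⟩
    ∑ (suc m) (f 0) + ∑ (suc m) (λ a → f (suc a) 0)
      ≈⟨ ∑-+ (suc m) (f 0) (λ a → f (suc a) 0) ⟨
    ∑ (suc m) (λ k → f 0 k + f (suc k) 0)
      ≈⟨ ∑-zero (suc m) (λ k _ → trans (+-congˡ (anti 0 k)) (-‿inverseʳ _)) ⟩
    0# ∎
    where
    g : ℕ → ℕ → Carrier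
    g a k = f (suc a) (suc k)

  adjacentRows : ∀ n a (N : Matrix) → suc a ℕ.< n → (∀ j → N a j ≈ N (suc a) j) → Det n N ≈ 0#
  adjacentRows (suc n) (suc a) N (ℕ.s≤s sa<n) equal = ∑-zero (suc n) λ j _ →
    cofactorTerm-zero n N j (adjacentRows n a (minor N j) sa<n (λ k → equal (skip j k)))
  adjacentRows (suc zero) zero N (ℕ.s≤s ()) equal
  adjacentRows (suc (suc m)) zero N _ equal = begin
    Det (suc (suc m)) N                     ≈⟨ ∑-cong (suc (suc m)) (λ a _ → expand a) ⟩
    ∑ (suc (suc m)) (λ a → ∑ (suc m) (f a)) ≈⟨ ∑∑-antisymmetric (suc m) f anti ⟩
    0#                                      ∎
    where
    -- expansion along row 0 and then along row 1 (row 0 of the minor)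
    D₂ : ℕ → ℕ → Carrier
    D₂ a k = Det m (minor (minor N a) k)
    f : ℕ → ℕ → Carrier
    f a k = sign a * (N 0 a * (sign k * (N 1 (skip a k) * D₂ a k)))
    expand : ∀ a → cofactorTerm (suc m) N a ≈ ∑ (suc m) (f a)
    expand a = begin
      sign a * (N 0 a * ∑ (suc m) t)              ≈⟨ *-congˡ (∑-*ˡ (suc m) (N 0 a) t) ⟨
      sign a * ∑ (suc m) (λ k → N 0 a * t k)      ≈⟨ ∑-*ˡ (suc m) (sign a) (λ k → N 0 a * t k) ⟨
      ∑ (suc m) (f a)                             ∎
      where
      t = λ k → sign k * (N 1 (skip a k) * D₂ a k)
    anti : ∀ a k → f (skip a k) (unskip (skip a k) a) ≈ - f a k
    anti a k = begin
      sign a′ * (N 0 a′ * (sign k′ * (N 1 (skip a′ k′) * D₂ a′ k′)))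
        ≈⟨ *-congˡ (*-cong (equal a′) (*-congˡ (*-cong (trans (reflexive (≡.cong (N 1) (skip-unskip a′ a a′≢a))) (sym (equal a)))
             (Det-cong m (λ r l _ _ → reflexive (≡.cong (N (suc (suc r))) (skip-skip a k l))))))) ⟩
      sign a′ * (N 1 a′ * (sign k′ * (N 0 a * D₂ a k)))
        ≈⟨ solve 5 (λ s t p q d → s :* (q :* (t :* (p :* d))) := (s :* t) :* (p :* (q :* d))) refl _ _ _ _ _ ⟩
      (sign a′ * sign k′) * (N 0 a * (N 1 a′ * D₂ a k))
        ≈⟨ *-congʳ (sign-swap a k) ⟩
      - (sign a * sign k) * (N 0 a * (N 1 a′ * D₂ a k))
        ≈⟨ solve 5 (λ s t p q d → (:- (s :* t)) :* (p :* (q :* d)) := :- (s :* (p :* (t :* (q :* d))))) refl _ _ _ _ _ ⟩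
      - f a k ∎
      where
      a′ = skip a k
      k′ = unskip a′ a
      a′≢a : a′ ≢ a
      a′≢a = skip-≢ a k

module ElementaryOperations {c ℓ} (R : CommutativeRing c ℓ) where
  open CommutativeRing R hiding (zero)
  open Determinant R
  open Multilinearity R
  open Alternating R
  open import Relation.Binary.Reasoning.Setoid setoid

  collapse : ℕ → ℕ → ℕ
  collapse zero    zero          = zero
  collapse zero    (suc zero)    = zero
  collapse zero    (suc (suc j)) = suc (suc j)
  collapse (suc a) zero          = zero
  collapse (suc a) (suc j)       = suc (collapse a j)

  collapse-at : ∀ a → collapse a (suc a) ≡ a
  collapse-at zero    = ≡.refl
  collapse-at (suc a) = ≡.cong suc (collapse-at a)

  collapse-off : ∀ a j → j ≢ suc a → collapse a j ≡ j
  collapse-off zero    zero          _   = ≡.refl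
  collapse-off zero    (suc zero)    j≢1 = ⊥-elim (j≢1 ≡.refl)
  collapse-off zero    (suc (suc j)) _   = ≡.refl
  collapse-off (suc a) zero          _   = ≡.refl
  collapse-off (suc a) (suc j)       j≢a = ≡.cong suc (collapse-off a j (j≢a ∘ ≡.cong suc))

  collapse-pair : ∀ a → collapse a a ≡ collapse a (suc a)
  collapse-pair a = ≡.trans (collapse-off a a (ℕP.1+n≢n ∘ ≡.sym)) (≡.sym (collapse-at a))

  addAdjacentColumn : ∀ n a x (N N′ : Matrix) → (∀ i j → j ≢ suc a → N′ i j ≈ N i j) →
                      (∀ i → N′ i (suc a) ≈ N i (suc a) + x * N i a) → Det n N′ ≈ Det n N
  addAdjacentColumn n a x N N′ same changed with suc a ℕP.<? n
  ... | no  sa≮n = Det-cong n (λ i j _ j<n → same i j λ { ≡.refl → sa≮n j<n })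
  ... | yes sa<n = begin
    Det n N′              ≈⟨ columnLinear n (suc a) N′ N D x sa<n (λ i j j≢ → sym (same i j j≢))
                               (λ i j j≢ → trans (reflexive (≡.cong (N i) (collapse-off a j j≢))) (sym (same i j j≢)))
                               (λ i → trans (changed i) (+-congˡ (*-congˡ (reflexive (≡.cong (N i) (≡.sym (collapse-at a))))))) ⟩
    Det n N + x * Det n D ≈⟨ +-congˡ (*-congˡ (adjacentColumns n a D sa<n (λ i → reflexive (≡.cong (N i) (collapse-pair a))))) ⟩
    Det n N + x * 0#      ≈⟨ +-congˡ (zeroʳ x) ⟩
    Det n N + 0#          ≈⟨ +-identityʳ _ ⟩
    Det n N               ∎
    where
    -- N with column a+1 replaced by column a
    D : Matrix
    D i j = N i (collapse a j)

  addAdjacentRow : ∀ n a x (N N′ : Matrix) → (∀ i j → i ≢ suc a → N′ i j ≈ N i j) →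
                   (∀ j → N′ (suc a) j ≈ N (suc a) j + x * N a j) → Det n N′ ≈ Det n N
  addAdjacentRow n a x N N′ same changed with suc a ℕP.<? n
  ... | no  sa≮n = Det-cong n (λ i j i<n _ → same i j λ { ≡.refl → sa≮n i<n })
  ... | yes sa<n = begin
    Det n N′              ≈⟨ rowLinear n (suc a) N′ N D x sa<n (λ i j i≢ → sym (same i j i≢))
                               (λ i j i≢ → trans (reflexive (≡.cong (λ r → N r j) (collapse-off a i i≢))) (sym (same i j i≢)))
                               (λ j → trans (changed j) (+-congˡ (*-congˡ (reflexive (≡.cong (λ r → N r j) (≡.sym (collapse-at a))))))) ⟩
    Det n N + x * Det n D
      ≈⟨ +-congˡ (*-congˡ (adjacentRows n a D sa<n (λ j → reflexive (≡.cong (λ r → N r j) (collapse-pair a))))) ⟩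
    Det n N + x * 0#      ≈⟨ +-congˡ (zeroʳ x) ⟩
    Det n N + 0#          ≈⟨ +-identityʳ _ ⟩
    Det n N               ∎
    where
    -- N with row a+1 replaced by row a
    D : Matrix
    D i j = N (collapse a i) j

  -- pass m x v adds x·v(k-1) to every entry v k with k > m, using the old values.
  pass : ℕ → Carrier → Row → Row
  pass zero    x v zero    = v zero
  pass zero    x v (suc k) = v (suc k) + x * v k
  pass (suc m) x v zero    = v zero
  pass (suc m) x v (suc k) = pass m x (v ∘ suc) k

  pass-below : ∀ m x v k → k ℕ.≤ m → pass m x v k ≡ v k
  pass-below zero    x v zero    _           = ≡.refl
  pass-below (suc m) x v zero    _           = ≡.refl
  pass-below (suc m) x v (suc k) (ℕ.s≤s k≤m) = pass-below m x (v ∘ suc) k k≤m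

  -- pass m is pass (m+1) followed by one adjacent operation at entry m+1.
  pass-off : ∀ m x v k → k ≢ suc m → pass m x v k ≡ pass (suc m) x v k
  pass-off zero    x v zero          _   = ≡.refl
  pass-off zero    x v (suc zero)    k≢1 = ⊥-elim (k≢1 ≡.refl)
  pass-off zero    x v (suc (suc k)) _   = ≡.refl
  pass-off (suc m) x v zero          _   = ≡.refl
  pass-off (suc m) x v (suc k)       k≢m = pass-off m x (v ∘ suc) k (k≢m ∘ ≡.cong suc)

  pass-at : ∀ m x v → pass m x v (suc m) ≡ pass (suc m) x v (suc m) + x * pass (suc m) x v m
  pass-at zero    x v = ≡.refl
  pass-at (suc m) x v = pass-at m x (v ∘ suc)

  columnPass : ℕ → Carrier → Matrix → Matrix
  columnPass m x N i = pass m x (N i)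

  rowPass : ℕ → Carrier → Matrix → Matrix
  rowPass m x N i j = pass m x (λ r → N r j) i

  stepwise-constant : ∀ (g : ℕ → Carrier) → (∀ m → g m ≈ g (suc m)) → ∀ k m → g m ≈ g (k ℕ.+ m)
  stepwise-constant g step zero    m = refl
  stepwise-constant g step (suc k) m = trans (stepwise-constant g step k m) (step (k ℕ.+ m))

  pass-beyond : ∀ n m x v k → k ℕ.< n → pass (n ℕ.+ m) x v k ≈ v k
  pass-beyond n m x v k k<n = reflexive (pass-below (n ℕ.+ m) x v k (ℕP.≤-trans (ℕP.<⇒≤ k<n) (ℕP.m≤m+n n m)))

  Det-columnPass : ∀ n m x N → Det n (columnPass m x N) ≈ Det n N
  Det-columnPass n m x N = begin
    Det n (columnPass m x N)         ≈⟨ stepwise-constant (λ m → Det n (columnPass m x N)) step n m ⟩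
    Det n (columnPass (n ℕ.+ m) x N) ≈⟨ Det-cong n (λ i j _ j<n → pass-beyond n m x (N i) j j<n) ⟩
    Det n N                          ∎
    where
    step : ∀ m → Det n (columnPass m x N) ≈ Det n (columnPass (suc m) x N)
    step m = addAdjacentColumn n m x (columnPass (suc m) x N) (columnPass m x N)
               (λ i j j≢ → reflexive (pass-off m x (N i) j j≢)) (λ i → reflexive (pass-at m x (N i)))

  Det-rowPass : ∀ n m x N → Det n (rowPass m x N) ≈ Det n N
  Det-rowPass n m x N = begin
    Det n (rowPass m x N)         ≈⟨ stepwise-constant (λ m → Det n (rowPass m x N)) step n m ⟩
    Det n (rowPass (n ℕ.+ m) x N) ≈⟨ Det-cong n (λ i j i<n _ → pass-beyond n m x (λ r → N r j) i i<n) ⟩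
    Det n N                       ∎
    where
    step : ∀ m → Det n (rowPass m x N) ≈ Det n (rowPass (suc m) x N)
    step m = addAdjacentRow n m x (rowPass (suc m) x N) (rowPass m x N)
               (λ i j i≢ → reflexive (pass-off m x (λ r → N r j) i i≢)) (λ j → reflexive (pass-at m x (λ r → N r j)))

module Tridiagonal {c ℓ} (R : CommutativeRing c ℓ) where
  open CommutativeRing R hiding (zero)
  open RingDefs R
  open Determinant R
  open Multilinearity R
  open ElementaryOperations R
  open import Algebra.Properties.Ring ring using (-1*x≈-x)
  open import Relation.Binary.Reasoning.Setoid setoid

  shift : Row → Row
  shift v zero    = 0#
  shift v (suc j) = v j

  withTop : Row → (ℕ → Row) → Matrix
  withTop t r zero    = t
  withTop t r (suc i) = r i

  -- Each row is the previous row plus its shift, i.e. r b = (1 + shift)^b (r 0).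
  IsPascal : (ℕ → Row) → Set ℓ
  IsPascal r = ∀ b j → r (suc b) j ≈ r b j + shift (r b) j

  -- The rows after m difference passes: row i becomes shift^i (r 0) once i ≤ m.
  stair : (ℕ → Row) → ℕ → ℕ → Row
  stair r zero    i       = r i
  stair r (suc m) zero    = r zero
  stair r (suc m) (suc i) = shift (stair r m i)

  pass-zeroes : ∀ m x i → pass m x (λ _ → 0#) i ≈ 0#
  pass-zeroes zero    x zero    = refl
  pass-zeroes zero    x (suc i) = trans (+-identityˡ _) (zeroʳ x)
  pass-zeroes (suc m) x zero    = refl
  pass-zeroes (suc m) x (suc i) = pass-zeroes m x i

  stair-pass : ∀ {r} → IsPascal r → ∀ m i j → pass m (- 1#) (λ k → stair r m k j) i ≈ stair r (suc m) i j
  stair-pass         pascal zero    zero    j       = refl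
  stair-pass {r = r} pascal zero    (suc i) j       = begin
    r (suc i) j + - 1# * r i j       ≈⟨ +-cong (pascal i j) (-1*x≈-x _) ⟩
    (r i j + shift (r i) j) - r i j  ≈⟨ +-congʳ (+-comm _ _) ⟩
    (shift (r i) j + r i j) - r i j  ≈⟨ +-assoc _ _ _ ⟩
    shift (r i) j + (r i j - r i j)  ≈⟨ +-congˡ (-‿inverseʳ _) ⟩
    shift (r i) j + 0#               ≈⟨ +-identityʳ _ ⟩
    shift (r i) j                    ∎
  stair-pass         pascal (suc m) zero    j       = refl
  stair-pass         pascal (suc m) (suc i) zero    = pass-zeroes m (- 1#) i
  stair-pass         pascal (suc m) (suc i) (suc j) = stair-pass pascal m i j

  staircase : ∀ {r} → IsPascal r → ∀ n t → Det n (withTop t r) ≈ Det n (withTop t (stair r n))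
  staircase {r} pascal n t = begin
    Det n (withTop t (stair r 0))          ≈⟨ stepwise-constant (λ m → Det n (withTop t (stair r m))) step n 0 ⟩
    Det n (withTop t (stair r (n ℕ.+ 0)))  ≡⟨ ≡.cong (λ m → Det n (withTop t (stair r m))) (ℕP.+-identityʳ n) ⟩
    Det n (withTop t (stair r n))          ∎
    where
    step : ∀ m → Det n (withTop t (stair r m)) ≈ Det n (withTop t (stair r (suc m)))
    step m = begin
      Det n (withTop t (stair r m))                         ≈⟨ Det-rowPass n (suc m) (- 1#) _ ⟨
      Det n (rowPass (suc m) (- 1#) (withTop t (stair r m))) ≈⟨ Det-cong n passed ⟩
      Det n (withTop t (stair r (suc m)))                   ∎
      where
      passed : ∀ i j → i ℕ.< n → j ℕ.< n →
               rowPass (suc m) (- 1#) (withTop t (stair r m)) i j ≈ withTop t (stair r (suc m)) i j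
      passed zero    j _ _ = refl
      passed (suc i) j _ _ = stair-pass pascal m i j

  unitRow : Row
  unitRow zero    = 1#
  unitRow (suc j) = 0#

  -- The tridiagonal matrix with diagonal a and all entries beside the diagonal 1.
  tridiag : (ℕ → Carrier) → Matrix
  tridiag a zero    zero          = a 0
  tridiag a zero    (suc zero)    = 1#
  tridiag a zero    (suc (suc j)) = 0#
  tridiag a (suc i) zero          = unitRow i
  tridiag a (suc i) (suc j)       = tridiag (a ∘ suc) i j

  band : Carrier → Row
  band d zero                = 1#
  band d (suc zero)          = d
  band d (suc (suc zero))    = 1#
  band d (suc (suc (suc j))) = 0#

  band-tridiag : ∀ a d → (∀ k → a (suc k) ≈ d) → ∀ j → band d j ≈ tridiag a 1 j
  band-tridiag a d a≈d zero                = refl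
  band-tridiag a d a≈d (suc zero)          = sym (a≈d 0)
  band-tridiag a d a≈d (suc (suc zero))    = refl
  band-tridiag a d a≈d (suc (suc (suc j))) = refl

  stair-tridiag : ∀ r a d → (∀ k → a (suc k) ≈ d) → (∀ j → r 0 j ≈ band d j) →
                  ∀ m i j → i ℕ.≤ m → stair r m i j ≈ tridiag a (suc i) j
  stair-tridiag r a d a≈d r₀ zero    zero    j       _ = trans (r₀ j) (band-tridiag a d a≈d j)
  stair-tridiag r a d a≈d r₀ (suc m) zero    j       _ = trans (r₀ j) (band-tridiag a d a≈d j)
  stair-tridiag r a d a≈d r₀ (suc m) (suc i) zero    _ = refl
  stair-tridiag r a d a≈d r₀ (suc m) (suc i) (suc j) (ℕ.s≤s i≤m) =
    stair-tridiag r (a ∘ suc) d (a≈d ∘ suc) r₀ m i j i≤m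

  -- Expanding along the first row, and then along the first row of the second minor:
  -- the continuant recurrence.
  Det-tridiag : ∀ k a → Det (suc (suc k)) (tridiag a) ≈
                a 0 * Det (suc k) (tridiag (a ∘ suc)) - Det k (tridiag (a ∘ suc ∘ suc))
  Det-tridiag k a = begin
    sign 0 * (a 0 * E₁) + (sign 1 * (1# * Det (suc k) M₁) + ∑ k rest)
      ≈⟨ +-cong (*-identityˡ _) (+-cong (*-congˡ (*-congˡ second)) (∑-zero k (λ j _ → cofactorTerm-zeroEntry (suc k) T (suc (suc j)) refl))) ⟩
    a 0 * E₁ + (- 1# * (1# * E₂) + 0#)
      ≈⟨ +-congˡ (trans (+-identityʳ _) (trans (-1*x≈-x _) (-‿cong (*-identityˡ E₂)))) ⟩
    a 0 * E₁ - E₂ ∎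
    where
    T = tridiag a
    E₁ = Det (suc k) (tridiag (a ∘ suc))
    E₂ = Det k (tridiag (a ∘ suc ∘ suc))
    M₁ = minor T 1
    rest = λ j → cofactorTerm (suc k) T (suc (suc j))
    -- the minor at column 1 has first row (1, 1, 0, …), and its second term has a zero column
    second : Det (suc k) M₁ ≈ E₂
    second = begin
      sign 0 * (1# * E₂) + ∑ k (λ l → cofactorTerm k M₁ (suc l))
        ≈⟨ +-cong (trans (*-identityˡ _) (*-identityˡ _)) (∑-zero k vanishing) ⟩
      E₂ + 0# ≈⟨ +-identityʳ _ ⟩
      E₂ ∎
      where
      vanishing : ∀ l → l ℕ.< k → cofactorTerm k M₁ (suc l) ≈ 0#
      vanishing zero    0<k = cofactorTerm-zero k M₁ 1 (zeroColumn k 0 (minor M₁ 1) 0<k (λ _ → refl))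
      vanishing (suc l) _   = cofactorTerm-zeroEntry k M₁ (suc (suc l)) refl

module UpToSums {c ℓ} (R : CommutativeRing c ℓ) where
  open CommutativeRing R hiding (zero)
  open RingDefs R
  open IntegerCoefficients R
  open import Relation.Binary.Reasoning.Setoid setoid

  sumUpTo-cong : ∀ n {f g : ℕ → Carrier} → (∀ h → h ℕ.≤ n → f h ≈ g h) → sumUpTo n f ≈ sumUpTo n g
  sumUpTo-cong zero    f≈g = f≈g 0 ℕ.z≤n
  sumUpTo-cong (suc n) f≈g = +-cong (sumUpTo-cong n (λ h h≤n → f≈g h (ℕP.m≤n⇒m≤1+n h≤n))) (f≈g (suc n) ℕP.≤-refl)

  sumUpTo-+ : ∀ n (f g : ℕ → Carrier) → sumUpTo n (λ h → f h + g h) ≈ sumUpTo n f + sumUpTo n g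
  sumUpTo-+ zero    f g = refl
  sumUpTo-+ (suc n) f g = trans (+-congʳ (sumUpTo-+ n f g))
    (solve 4 (λ a b c d → (a :+ b) :+ (c :+ d) := (a :+ c) :+ (b :+ d)) refl _ _ _ _)

  sumUpTo-*ˡ : ∀ n a (f : ℕ → Carrier) → sumUpTo n (λ h → a * f h) ≈ a * sumUpTo n f
  sumUpTo-*ˡ zero    a f = refl
  sumUpTo-*ˡ (suc n) a f = trans (+-congʳ (sumUpTo-*ˡ n a f)) (sym (distribˡ _ _ _))

  sumUpTo-first : ∀ n (f : ℕ → Carrier) → sumUpTo (suc n) f ≈ f 0 + sumUpTo n (f ∘ suc)
  sumUpTo-first zero    f = refl
  sumUpTo-first (suc n) f = trans (+-congʳ (sumUpTo-first n f)) (+-assoc _ _ _)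

  sumUpTo-reverse : ∀ n (f : ℕ → Carrier) → sumUpTo n f ≈ sumUpTo n (λ h → f (n ∸ h))
  sumUpTo-reverse zero    f = refl
  sumUpTo-reverse (suc n) f = begin
    sumUpTo n f + f (suc n)                      ≈⟨ +-comm _ _ ⟩
    f (suc n) + sumUpTo n f                      ≈⟨ +-congˡ (sumUpTo-reverse n f) ⟩
    f (suc n) + sumUpTo n (λ h → f (n ∸ h))      ≈⟨ sumUpTo-first n (λ h → f (suc n ∸ h)) ⟨
    sumUpTo (suc n) (λ h → f (suc n ∸ h))        ∎

module MorganVoyce {c ℓ} (R : CommutativeRing c ℓ) (X : CommutativeRing.Carrier R) where
  open CommutativeRing R hiding (zero)
  open RingDefs R
  open IntegerCoefficients R
  open UpToSums R
  open Determinant R using (Det; Det-one)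
  open Tridiagonal R using (tridiag; Det-tridiag)
  open import Relation.Binary.Reasoning.Setoid setoid

  choose : ℕ → ℕ → Carrier
  choose n k = fromℕ (n C k)

  choose-pascal : ∀ n k → choose (suc n) (suc k) ≈ choose n k + choose n (suc k)
  choose-pascal n k = trans (reflexive (≡.cong fromℕ (≡.sym (nCk+nC[k+1]≡[n+1]C[k+1] n k))))
                            (fromℕ-+ (n C k) (n C suc k))

  choose-beyond : ∀ n k → n ℕ.< k → choose n k ≈ 0#
  choose-beyond n k n<k = reflexive (≡.cong fromℕ (k>n⇒nCk≡0 n<k))

  b B : ℕ → Carrier
  b n = sumUpTo n (λ h → choose (n ℕ.+ h) (2 ℕ.* h) * pow X h)
  B n = sumUpTo n (λ h → choose (suc (n ℕ.+ h)) (suc (2 ℕ.* h)) * pow X h)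

  2*suc : ∀ h → 2 ℕ.* suc h ≡ suc (suc (2 ℕ.* h))
  2*suc h = ≡.cong suc (ℕP.+-suc h (h ℕ.+ 0))

  -- The top coefficient C(2n+1, 2n+2) of the extended sums vanishes.
  top-vanishes : ∀ n → n ℕ.+ suc n ℕ.< 2 ℕ.* suc n
  top-vanishes n = ℕP.≤-reflexive (≡.sym (≡.trans (2*suc n)
                     (≡.cong suc (≡.trans (≡.cong (suc ∘ (n ℕ.+_)) (ℕP.+-identityʳ n)) (≡.sym (ℕP.+-suc n n))))))

  b-step : ∀ n → b (suc n) ≈ b n + X * B n
  b-step n = begin
    sumUpTo (suc n) f                             ≈⟨ sumUpTo-first n f ⟩
    f 0 + sumUpTo n (f ∘ suc)                     ≈⟨ +-congˡ (sumUpTo-cong n (λ h _ → f-step h)) ⟩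
    g 0 + sumUpTo n (λ h → X * G h + g (suc h))
      ≈⟨ +-congˡ (trans (sumUpTo-+ n (λ h → X * G h) (g ∘ suc)) (+-congʳ (sumUpTo-*ˡ n X G))) ⟩
    g 0 + (X * B n + sumUpTo n (g ∘ suc))         ≈⟨ solve 3 (λ a b c → a :+ (b :+ c) := (a :+ c) :+ b) refl _ _ _ ⟩
    (g 0 + sumUpTo n (g ∘ suc)) + X * B n         ≈⟨ +-congʳ (sumUpTo-first n g) ⟨
    (b n + g (suc n)) + X * B n
      ≈⟨ +-congʳ (+-congˡ (trans (*-congʳ (choose-beyond _ _ (top-vanishes n))) (zeroˡ _))) ⟩
    (b n + 0#) + X * B n                          ≈⟨ +-congʳ (+-identityʳ _) ⟩
    b n + X * B n                                 ∎
    where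
    f g G : ℕ → Carrier
    f h = choose (suc n ℕ.+ h) (2 ℕ.* h) * pow X h
    g h = choose (n ℕ.+ h) (2 ℕ.* h) * pow X h
    G h = choose (suc (n ℕ.+ h)) (suc (2 ℕ.* h)) * pow X h
    f-step : ∀ h → f (suc h) ≈ X * G h + g (suc h)
    f-step h = begin
      choose (suc (n ℕ.+ suc h)) (2 ℕ.* suc h) * pow X (suc h)
        ≡⟨ ≡.cong (λ k → choose (suc (n ℕ.+ suc h)) k * pow X (suc h)) (2*suc h) ⟩
      choose (suc (n ℕ.+ suc h)) (suc (suc (2 ℕ.* h))) * (X * pow X h)
        ≈⟨ *-congʳ (choose-pascal (n ℕ.+ suc h) (suc (2 ℕ.* h))) ⟩
      (choose (n ℕ.+ suc h) (suc (2 ℕ.* h)) + choose (n ℕ.+ suc h) (suc (suc (2 ℕ.* h)))) * (X * pow X h)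
        ≈⟨ solve 4 (λ p q X t → (p :+ q) :* (X :* t) := X :* (p :* t) :+ q :* (X :* t)) refl _ _ X _ ⟩
      X * (choose (n ℕ.+ suc h) (suc (2 ℕ.* h)) * pow X h) + choose (n ℕ.+ suc h) (suc (suc (2 ℕ.* h))) * pow X (suc h)
        ≡⟨ ≡.cong₂ (λ u v → X * (choose u (suc (2 ℕ.* h)) * pow X h) + choose (n ℕ.+ suc h) v * pow X (suc h))
                   (ℕP.+-suc n h) (≡.sym (2*suc h)) ⟩
      X * G h + g (suc h) ∎

  B-step : ∀ n → B (suc n) ≈ B n + b (suc n)
  B-step n = begin
    sumUpTo (suc n) (λ h → choose (suc (suc n ℕ.+ h)) (suc (2 ℕ.* h)) * pow X h)
      ≈⟨ sumUpTo-cong (suc n) (λ h _ → trans (*-congʳ (choose-pascal (suc n ℕ.+ h) (2 ℕ.* h))) (distribʳ _ _ _)) ⟩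
    sumUpTo (suc n) (λ h → choose (suc n ℕ.+ h) (2 ℕ.* h) * pow X h + choose (suc n ℕ.+ h) (suc (2 ℕ.* h)) * pow X h)
      ≈⟨ sumUpTo-+ (suc n) _ _ ⟩
    b (suc n) + (B n + choose (suc (n ℕ.+ suc n)) (suc (2 ℕ.* suc n)) * pow X (suc n))
      ≈⟨ +-congˡ (+-congˡ (trans (*-congʳ (choose-beyond _ _ (ℕ.s≤s (top-vanishes n)))) (zeroˡ _))) ⟩
    b (suc n) + (B n + 0#)  ≈⟨ +-congˡ (+-identityʳ _) ⟩
    b (suc n) + B n         ≈⟨ +-comm _ _ ⟩
    B n + b (suc n)         ∎

  two : Carrier
  two = fromℕ 2

  b-diff : ∀ k → b (suc k) ≈ B (suc k) - B k
  b-diff k = begin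
    b (suc k)                   ≈⟨ solve 2 (λ p q → p := (q :+ p) :- q) refl _ _ ⟩
    (B k + b (suc k)) - B k     ≈⟨ +-congʳ (B-step k) ⟨
    B (suc k) - B k             ∎

  B-recurrence : ∀ k → B (suc (suc k)) ≈ (X + two) * B (suc k) - B k
  B-recurrence k = begin
    B (suc (suc k))                             ≈⟨ B-step (suc k) ⟩
    B (suc k) + b (suc (suc k))                 ≈⟨ +-congˡ (b-step (suc k)) ⟩
    B (suc k) + (b (suc k) + X * B (suc k))     ≈⟨ +-congˡ (+-congʳ (b-diff k)) ⟩
    B (suc k) + ((B (suc k) - B k) + X * B (suc k))
      ≈⟨ solve 3 (λ X p q → p :+ ((p :- q) :+ X :* p) := (X :+ con (+ 2)) :* p :- q) refl X _ _ ⟩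
    (X + two) * B (suc k) - B k                 ∎

  b-recurrence : ∀ k → b (suc (suc k)) ≈ (X + fromℕ 1) * B (suc k) - B k
  b-recurrence k = begin
    b (suc (suc k))                         ≈⟨ b-step (suc k) ⟩
    b (suc k) + X * B (suc k)               ≈⟨ +-congʳ (b-diff k) ⟩
    (B (suc k) - B k) + X * B (suc k)
      ≈⟨ solve 3 (λ X p q → (p :- q) :+ X :* p := (X :+ con (+ 1)) :* p :- q) refl X _ _ ⟩
    (X + fromℕ 1) * B (suc k) - B k         ∎

  b₀ : b 0 ≈ fromℕ 1
  b₀ = *-identityʳ _

  B₀ : B 0 ≈ fromℕ 1
  B₀ = *-identityʳ _

  B₁ : B 1 ≈ X + two
  B₁ = begin
    B 1                      ≈⟨ B-step 0 ⟩
    B 0 + b 1                ≈⟨ +-cong B₀ (b-step 0) ⟩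
    fromℕ 1 + (b 0 + X * B 0) ≈⟨ +-congˡ (+-cong b₀ (*-congˡ B₀)) ⟩
    fromℕ 1 + (fromℕ 1 + X * fromℕ 1)
      ≈⟨ solve 1 (λ X → con (+ 1) :+ (con (+ 1) :+ X :* con (+ 1)) := X :+ con (+ 2)) refl X ⟩
    X + two                  ∎

  b₁ : b 1 ≈ X + fromℕ 1
  b₁ = begin
    b 1                      ≈⟨ b-step 0 ⟩
    b 0 + X * B 0            ≈⟨ +-cong b₀ (*-congˡ B₀) ⟩
    fromℕ 1 + X * fromℕ 1    ≈⟨ solve 1 (λ X → con (+ 1) :+ X :* con (+ 1) := X :+ con (+ 1)) refl X ⟩
    X + fromℕ 1              ∎

  diagonal : ℕ → Carrier
  diagonal zero    = X + fromℕ 1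
  diagonal (suc k) = X + two

  Det-tridiag-B : ∀ k → (Det k (tridiag (λ _ → X + two)) ≈ B k) × (Det (suc k) (tridiag (λ _ → X + two)) ≈ B (suc k))
  Det-tridiag-B zero    = sym (trans B₀ (+-identityʳ 1#)) , trans (Det-one (tridiag (λ _ → X + two))) (sym B₁)
  Det-tridiag-B (suc k) with Det-tridiag-B k
  ... | E₀ , E₁ = E₁ , (begin
    Det (suc (suc k)) (tridiag (λ _ → X + two))  ≈⟨ Det-tridiag k (λ _ → X + two) ⟩
    (X + two) * Det (suc k) (tridiag (λ _ → X + two)) - Det k (tridiag (λ _ → X + two))
                                                 ≈⟨ +-cong (*-congˡ E₁) (-‿cong E₀) ⟩
    (X + two) * B (suc k) - B k                  ≈⟨ B-recurrence k ⟨
    B (suc (suc k))                              ∎)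

  Det-tridiag-b : ∀ k → Det k (tridiag diagonal) ≈ b k
  Det-tridiag-b zero          = sym (trans b₀ (+-identityʳ 1#))
  Det-tridiag-b (suc zero)    = trans (Det-one (tridiag diagonal)) (sym b₁)
  Det-tridiag-b (suc (suc k)) = begin
    Det (suc (suc k)) (tridiag diagonal)   ≈⟨ Det-tridiag k diagonal ⟩
    (X + fromℕ 1) * Det (suc k) (tridiag (λ _ → X + two)) - Det k (tridiag (λ _ → X + two))
      ≈⟨ +-cong (*-congˡ (proj₂ (Det-tridiag-B k))) (-‿cong (proj₁ (Det-tridiag-B k))) ⟩
    (X + fromℕ 1) * B (suc k) - B k        ≈⟨ b-recurrence k ⟨
    b (suc (suc k))                        ∎

module TheoremMatrix {c ℓ} (R : CommutativeRing c ℓ) (X : CommutativeRing.Carrier R) where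
  open CommutativeRing R hiding (zero)
  open RingDefs R
  open IntegerCoefficients R
  open Determinant R
  open ElementaryOperations R
  open Tridiagonal R
  open UpToSums R using (sumUpTo-cong)
  open MorganVoyce R X
  open Binomial
  open import Algebra.Properties.Ring ring using (-1*x≈-x)
  open import Relation.Binary.Reasoning.Setoid setoid

  theMatrix : Matrix
  theMatrix i j = fromℤ (binom (+ i ℤ.- + 1) j) * X + fromℤ (binom (+ suc i) (suc j))

  fromℤ-signℤ : ∀ j → fromℤ (signℤ j) ≈ sign j
  fromℤ-signℤ zero    = +-identityʳ 1#
  fromℤ-signℤ (suc j) = trans (fromℤ-neg (signℤ j)) (-‿cong (fromℤ-signℤ j))

  fromℤ-binom : ∀ n k → fromℤ (binom (+ n) k) ≈ choose n k
  fromℤ-binom n k = reflexive (≡.cong fromℤ (binom-ℕ n k))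

  -- The entries C(n,k) X + C(n+2,k+1) of the rows below the first.
  Q : ℕ → ℕ → Carrier
  Q n k = choose n k * X + choose (suc (suc n)) (suc k)

  Q-pascal : ∀ n k → Q (suc n) (suc k) ≈ Q n k + Q n (suc k)
  Q-pascal n k = begin
    choose (suc n) (suc k) * X + choose (3 ℕ.+ n) (2 ℕ.+ k)
      ≈⟨ +-cong (*-congʳ (choose-pascal n k)) (choose-pascal (2 ℕ.+ n) (suc k)) ⟩
    (choose n k + choose n (suc k)) * X + (choose (2 ℕ.+ n) (suc k) + choose (2 ℕ.+ n) (2 ℕ.+ k))
      ≈⟨ solve 5 (λ p q r s X → (p :+ q) :* X :+ (r :+ s) := (p :* X :+ r) :+ (q :* X :+ s)) refl _ _ _ _ X ⟩
    Q n k + Q n (suc k) ∎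

  theMatrix-top : ∀ j → theMatrix 0 j ≈ sign j * X + choose 1 (suc j)
  theMatrix-top j = +-cong (*-congʳ (trans (reflexive (≡.cong fromℤ (binom-minusOne j))) (fromℤ-signℤ j)))
                           (fromℤ-binom 1 (suc j))

  theMatrix-below : ∀ i j → theMatrix (suc i) j ≈ Q i j
  theMatrix-below i j = +-cong (*-congʳ (fromℤ-binom i j)) (fromℤ-binom (2 ℕ.+ i) (suc j))

  -- The matrix after adding every column to the next one.
  columnReduced : Matrix
  columnReduced zero            = tridiag diagonal zero
  columnReduced (suc i) zero    = Q i 0
  columnReduced (suc i) (suc j) = Q (suc i) (suc j)

  columnPass-theMatrix : ∀ i j → columnPass 0 1# theMatrix i j ≈ columnReduced i j
  columnPass-theMatrix zero    zero          = trans (theMatrix-top 0) (+-congʳ (*-identityˡ X))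
  columnPass-theMatrix zero    (suc zero)    = begin
    theMatrix 0 1 + 1# * theMatrix 0 0                     ≈⟨ +-cong (theMatrix-top 1) (*-congˡ (theMatrix-top 0)) ⟩
    (- 1# * X + 0#) + 1# * (1# * X + fromℕ 1)
      ≈⟨ +-cong (+-congʳ (-1*x≈-x X)) (trans (*-identityˡ _) (+-congʳ (*-identityˡ X))) ⟩
    (- X + 0#) + (X + (1# + 0#))
      ≈⟨ solve 2 (λ X o → (:- X :+ con (+ 0)) :+ (X :+ (o :+ con (+ 0))) := o) refl X 1# ⟩
    1#                                                     ∎
  columnPass-theMatrix zero    (suc (suc j)) = begin
    theMatrix 0 (2 ℕ.+ j) + 1# * theMatrix 0 (suc j)
      ≈⟨ +-cong (theMatrix-top (2 ℕ.+ j)) (trans (*-identityˡ _) (theMatrix-top (suc j))) ⟩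
    (- - sign j * X + 0#) + (- sign j * X + 0#)
      ≈⟨ solve 2 (λ s X → (:- (:- s) :* X :+ con (+ 0)) :+ (:- s :* X :+ con (+ 0)) := con (+ 0)) refl (sign j) X ⟩
    0#                                                     ∎
  columnPass-theMatrix (suc i) zero          = theMatrix-below i 0
  columnPass-theMatrix (suc i) (suc j)       = begin
    theMatrix (suc i) (suc j) + 1# * theMatrix (suc i) j
      ≈⟨ +-cong (theMatrix-below i (suc j)) (trans (*-identityˡ _) (theMatrix-below i j)) ⟩
    Q i (suc j) + Q i j                                    ≈⟨ +-comm _ _ ⟩
    Q i j + Q i (suc j)                                    ≈⟨ Q-pascal i j ⟨
    Q (suc i) (suc j)                                      ∎

  -- The rows below the first after subtracting every row from the next one.
  P : ℕ → Row
  P i zero    = fromℕ 1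
  P i (suc j) = Q i j

  P-pascal : IsPascal P
  P-pascal b zero          = sym (+-identityʳ _)
  P-pascal b (suc zero)    = begin
    fromℕ 1 * X + choose (3 ℕ.+ b) 1                ≈⟨ +-congˡ (choose-pascal (2 ℕ.+ b) 0) ⟩
    fromℕ 1 * X + (fromℕ 1 + choose (2 ℕ.+ b) 1)
      ≈⟨ solve 3 (λ p X q → p :* X :+ (con (+ 1) :+ q) := (p :* X :+ q) :+ con (+ 1)) refl _ X _ ⟩
    Q b 0 + fromℕ 1                                 ∎
  P-pascal b (suc (suc j)) = trans (Q-pascal b j) (+-comm _ _)

  P-band : ∀ j → P 0 j ≈ band (X + two) j
  P-band zero                = +-identityʳ 1#
  P-band (suc zero)          = +-congʳ (trans (*-congʳ (+-identityʳ 1#)) (*-identityˡ X))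
  P-band (suc (suc zero))    = solve 2 (λ X o → con (+ 0) :* X :+ (o :+ con (+ 0)) := o) refl X 1#
  P-band (suc (suc (suc j))) = solve 1 (λ X → con (+ 0) :* X :+ con (+ 0) := con (+ 0)) refl X

  minusOne : ∀ y z → y + - 1# * z ≈ y - z
  minusOne y z = +-congˡ (-1*x≈-x z)

  rowPass-columnReduced : ∀ i j → rowPass 0 (- 1#) columnReduced i j ≈ withTop (tridiag diagonal 0) P i j
  rowPass-columnReduced zero          j             = refl
  rowPass-columnReduced (suc zero)    zero          = trans (minusOne _ _)
    (solve 1 (λ X → (con (+ 1) :* X :+ con (+ 2)) :- (X :+ con (+ 1)) := con (+ 1)) refl X)
  rowPass-columnReduced (suc zero)    (suc zero)    = trans (minusOne _ _) (trans (+-congˡ (-‿cong (sym (+-identityʳ 1#))))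
    (solve 1 (λ X → (con (+ 1) :* X :+ con (+ 3)) :- con (+ 1) := con (+ 1) :* X :+ con (+ 2)) refl X))
  rowPass-columnReduced (suc zero)    (suc (suc j)) = trans (+-congʳ (Q-pascal 0 (suc j)))
    (solve 3 (λ X q o → (q :+ (con (+ 0) :* X :+ con (+ 0))) :+ (:- o) :* con (+ 0) := q) refl X _ 1#)
  rowPass-columnReduced (suc (suc b)) zero          = begin
    Q (suc b) 0 + - 1# * Q b 0                                   ≈⟨ minusOne _ _ ⟩
    (fromℕ 1 * X + choose (3 ℕ.+ b) 1) - Q b 0                   ≈⟨ +-congʳ (+-congˡ (choose-pascal (2 ℕ.+ b) 0)) ⟩
    (fromℕ 1 * X + (fromℕ 1 + choose (2 ℕ.+ b) 1)) - (fromℕ 1 * X + choose (2 ℕ.+ b) 1)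
      ≈⟨ solve 2 (λ X q → (con (+ 1) :* X :+ (con (+ 1) :+ q)) :- (con (+ 1) :* X :+ q) := con (+ 1)) refl X _ ⟩
    fromℕ 1                                                      ∎
  rowPass-columnReduced (suc (suc b)) (suc j)       = begin
    Q (2 ℕ.+ b) (suc j) + - 1# * Q (suc b) (suc j)               ≈⟨ minusOne _ _ ⟩
    Q (2 ℕ.+ b) (suc j) - Q (suc b) (suc j)                      ≈⟨ +-congʳ (Q-pascal (suc b) j) ⟩
    (Q (suc b) j + Q (suc b) (suc j)) - Q (suc b) (suc j)        ≈⟨ solve 2 (λ p q → (p :+ q) :- q := p) refl _ _ ⟩
    Q (suc b) j                                                  ∎

  Det-theMatrix : ∀ n → Det n theMatrix ≈ b n
  Det-theMatrix n = begin
    Det n theMatrix                                  ≈⟨ Det-columnPass n 0 1# theMatrix ⟨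
    Det n (columnPass 0 1# theMatrix)                ≈⟨ Det-cong n (λ i j _ _ → columnPass-theMatrix i j) ⟩
    Det n columnReduced                              ≈⟨ Det-rowPass n 0 (- 1#) columnReduced ⟨
    Det n (rowPass 0 (- 1#) columnReduced)           ≈⟨ Det-cong n (λ i j _ _ → rowPass-columnReduced i j) ⟩
    Det n (withTop (tridiag diagonal 0) P)           ≈⟨ staircase P-pascal n _ ⟩
    Det n (withTop (tridiag diagonal 0) (stair P n)) ≈⟨ Det-cong n tridiagonal ⟩
    Det n (tridiag diagonal)                         ≈⟨ Det-tridiag-b n ⟩
    b n                                              ∎
    where
    tridiagonal : ∀ i j → i ℕ.< n → j ℕ.< n → withTop (tridiag diagonal 0) (stair P n) i j ≈ tridiag diagonal i j
    tridiagonal zero    j _    _ = refl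
    tridiagonal (suc i) j si<n _ =
      stair-tridiag P diagonal (X + two) (λ _ → refl) P-band n i j (ℕP.<⇒≤ (ℕP.<-trans (ℕP.n<1+n i) si<n))

  det-theMatrix : ∀ n → det n (λ i j → theMatrix (toℕ i) (toℕ j)) ≈
                        sumUpTo n (λ h → fromℤ (binom (+ (n ℕ.+ h)) (2 ℕ.* h)) * pow X h)
  det-theMatrix n = begin
    det n (λ i j → theMatrix (toℕ i) (toℕ j))  ≈⟨ det≈Det n _ theMatrix (λ _ _ → refl) ⟩
    Det n theMatrix                            ≈⟨ Det-theMatrix n ⟩
    b n                                        ≈⟨ sumUpTo-cong n (λ h _ → *-congʳ (sym (fromℤ-binom (n ℕ.+ h) (2 ℕ.* h)))) ⟩
    sumUpTo n (λ h → fromℤ (binom (+ (n ℕ.+ h)) (2 ℕ.* h)) * pow X h) ∎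

module Reindexing {c ℓ} (R : CommutativeRing c ℓ) (x : CommutativeRing.Carrier R) where
  open CommutativeRing R hiding (zero)
  open RingDefs R
  open UpToSums R
  open MorganVoyce R (x * x) using (choose; 2*suc)
  open TheoremMatrix R (x * x) using (fromℤ-binom)
  open import Relation.Binary.Reasoning.Setoid setoid

  pow-square : ∀ k → pow (x * x) k ≈ pow x (2 ℕ.* k)
  pow-square zero    = refl
  pow-square (suc k) = begin
    (x * x) * pow (x * x) k  ≈⟨ *-congˡ (pow-square k) ⟩
    (x * x) * pow x (2 ℕ.* k) ≈⟨ *-assoc _ _ _ ⟩
    x * (x * pow x (2 ℕ.* k)) ≡⟨ ≡.cong (pow x) (≡.sym (2*suc k)) ⟩
    pow x (2 ℕ.* suc k)      ∎

  T₁ T₂ : ℕ → ℕ → Carrier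
  T₁ n k = fromℤ (binom (+ (n ℕ.+ k)) (2 ℕ.* k)) * pow (x * x) k
  T₂ n h = fromℤ (binom (+ (2 ℕ.* n ∸ h)) h) * pow x (2 ℕ.* n ∸ 2 ℕ.* h)

  -- With n = h + k, the k-th term of the first sum is the h-th term of the second:
  -- both are C(n+k, h) x^{2k}, by the symmetry C(N, 2k) = C(N, N-2k).
  term-swap : ∀ h k → T₁ (h ℕ.+ k) k ≈ T₂ (h ℕ.+ k) h
  term-swap h k = begin
    fromℤ (binom (+ N) (2 ℕ.* k)) * pow (x * x) k        ≈⟨ *-cong (fromℤ-binom N (2 ℕ.* k)) (pow-square k) ⟩
    choose N (2 ℕ.* k) * pow x (2 ℕ.* k)                ≡⟨ ≡.cong₂ (λ u v → fromℕ u * pow x v) symmetric (≡.sym twice-k) ⟩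
    choose N h * pow x (2 ℕ.* (h ℕ.+ k) ∸ 2 ℕ.* h)
      ≡⟨ ≡.cong (λ u → choose u h * pow x (2 ℕ.* (h ℕ.+ k) ∸ 2 ℕ.* h)) (≡.sym top) ⟩
    choose (2 ℕ.* (h ℕ.+ k) ∸ h) h * pow x (2 ℕ.* (h ℕ.+ k) ∸ 2 ℕ.* h) ≈⟨ *-congʳ (fromℤ-binom _ h) ⟨
    T₂ (h ℕ.+ k) h                                       ∎
    where
    N = h ℕ.+ k ℕ.+ k
    N≡h+2k : N ≡ h ℕ.+ 2 ℕ.* k
    N≡h+2k = arithmetic h k
      where
      arithmetic : ∀ h k → h ℕ.+ k ℕ.+ k ≡ h ℕ.+ 2 ℕ.* k
      arithmetic = solve-∀
    symmetric : N C (2 ℕ.* k) ≡ N C h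
    symmetric = ≡.trans (nCk≡nC[n∸k] (ℕP.≤-trans (ℕP.m≤n+m (2 ℕ.* k) h) (ℕP.≤-reflexive (≡.sym N≡h+2k))))
                        (≡.cong (N C_) (≡.trans (≡.cong (_∸ 2 ℕ.* k) N≡h+2k) (ℕP.m+n∸n≡m h (2 ℕ.* k))))
    top : 2 ℕ.* (h ℕ.+ k) ∸ h ≡ N
    top = ≡.trans (≡.cong (_∸ h) (double h k)) (ℕP.m+n∸m≡n h N)
      where
      double : ∀ h k → 2 ℕ.* (h ℕ.+ k) ≡ h ℕ.+ (h ℕ.+ k ℕ.+ k)
      double = solve-∀
    twice-k : 2 ℕ.* (h ℕ.+ k) ∸ 2 ℕ.* h ≡ 2 ℕ.* k
    twice-k = ≡.trans (≡.cong (_∸ 2 ℕ.* h) (ℕP.*-distribˡ-+ 2 h k)) (ℕP.m+n∸m≡n (2 ℕ.* h) (2 ℕ.* k))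

  reindex : ∀ n → sumUpTo n (T₁ n) ≈ sumUpTo n (T₂ n)
  reindex n = trans (sumUpTo-reverse n (T₁ n)) (sumUpTo-cong n swapped)
    where
    swapped : ∀ h → h ℕ.≤ n → T₁ n (n ∸ h) ≈ T₂ n h
    swapped h h≤n = ≡.subst (λ m → T₁ m (m ∸ h) ≈ T₂ m h) (ℕP.m+[n∸m]≡n h≤n)
      (≡.subst (λ k → T₁ (h ℕ.+ (n ∸ h)) k ≈ T₂ (h ℕ.+ (n ∸ h)) h) (≡.sym (ℕP.m+n∸m≡n h (n ∸ h))) (term-swap h (n ∸ h)))

mainTheorem7 : ∀ {c ℓ} (R : CommutativeRing c ℓ) (x : CommutativeRing.Carrier R)
    (n : ℕ) → .{{_ : NonZero n}} →
    let open CommutativeRing R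
        open RingDefs R
        X = x * x
        M = λ i j → fromℤ (binom (+ toℕ i ℤ.- + 1) (toℕ j)) * X
                    + fromℤ (binom (+ suc (toℕ i)) (suc (toℕ j)))
        S₁ = sumUpTo n (λ h → fromℤ (binom (+ (n ℕ.+ h)) (2 ℕ.* h)) * pow X h)
        S₂ = sumUpTo n (λ h → fromℤ (binom (+ (2 ℕ.* n ∸ h)) h) * pow x (2 ℕ.* n ∸ 2 ℕ.* h))
    in (det n M ≈ S₁) × (S₁ ≈ S₂)
mainTheorem7 R x n = TheoremMatrix.det-theMatrix R (CommutativeRing._*_ R x x) n , Reindexing.reindex R x n
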